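{- Let $k\ge 0$ be an integer and $n=48k+22$. Define $c_3(r)\in\mathbb{Z}_n$ for $0\le r\le n-1$ as follows (all arithmetic modulo $n$): for $0\le i\le 12k+5$, $c_3(2i)=30k+14+i(12k+7)$; for $0\le i\le 12k+4$, $c_3(2i+1)=24k+12+i(12k+7)$ (this defines $c_3(r)$ for $0\le r\le 24k+10$); and for $0\le r\le 24k+10$, $c_3(n-1-r)=n-1-c_3(r)$. Let ${\cal L}_3=[l_3(r,j)]$ be the $n\times n$ array with $l_3(r,j)\equiv c_3(r)+j \pmod n$ for $0\le r,j\le n-1$. Then ${\cal L}_3$ is a Latin square of order $n$.
   Context: A Latin square of order $n$ is an $n\times n$ array in which each row and each column contains each of the symbols $0,1,\dots,n-1$ exactly once. -}

module Defs where

open import Data.Nat using (ℕ; zero; suc; _+_; _*_; _∸_; _≤?_; _%_; _/_; NonZero)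
open import Data.Nat.Properties using (_≟_)
open import Data.Fin using (Fin; toℕ; fromℕ<)
open import Data.Nat.DivMod using (m%n<n)
open import Data.Product using (Σ; _×_; _,_)
open import Relation.Binary.PropositionalEquality using (_≡_)
open import Relation.Nullary using (yes; no)

∃! : {A : Set} → (A → Set) → Set
∃! {A} P = Σ A λ x → P x × (∀ y → P y → y ≡ x)

IsLatinSquare : (n : ℕ) → (Fin n → Fin n → Fin n) → Set
IsLatinSquare n L =
  (∀ (r s : Fin n) → ∃! λ j → L r j ≡ s) ×
  (∀ (j s : Fin n) → ∃! λ r → L r j ≡ s)

-- the order n = 48k+22 (written suc (48k+21) so NonZero is found automatically)
ord : ℕ → ℕ
ord k = suc (48 * k + 21)

-- first half (0 ≤ r ≤ 24k+10), as a natural number before reduction mod n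
c3-half : ℕ → ℕ → ℕ
c3-half k r with r % 2 ≟ 0
... | yes _ = 30 * k + 14 + (r / 2) * (12 * k + 7)
... | no _  = 24 * k + 12 + (r / 2) * (12 * k + 7)

c3ℕ : ℕ → ℕ → ℕ
c3ℕ k r with r ≤? 24 * k + 10
... | yes _ = c3-half k r % ord k
... | no _  = (ord k ∸ 1) ∸ (c3-half k ((ord k ∸ 1) ∸ r) % ord k)

c3 : (k : ℕ) → ℕ → Fin (ord k)
c3 k r = fromℕ< (m%n<n (c3ℕ k r) (ord k))

L3 : (k : ℕ) → Fin (ord k) → Fin (ord k) → Fin (ord k)
L3 k r j = fromℕ< (m%n<n (toℕ (c3 k (toℕ r)) + toℕ j) (ord k))

-- Row r of L₃ is the cyclic shift of 0, 1, …, n−1 by c₃(r), so L₃ is a Latin square as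
-- soon as c₃ is injective. Modulo n, c₃(r) ≡ A + σ(r)·m with A = 30k+14 and m = 12k+7,
-- a unit since m·(40k+19) ≡ 1; here σ sends the even r ≤ 24k+10 to r/2 and the odd ones
-- to r/2 + 12k+6, and is extended to the upper half by conjugating with r ↦ n−1−r, which
-- is compatible with c₃ because 2A + (n−1)m ≡ n−1. Re-interleaving evens and odds is a
-- left inverse of σ on each half, so σ, and hence c₃, is injective.
module Submission where

open import Data.Nat using (ℕ; zero; suc; _+_; _*_; _∸_; _≤_; _<_; _≤?_; _%_; _/_; s≤s; NonZero)
open import Data.Nat.Properties
open import Data.Nat.DivMod
open import Data.Nat.Tactic.RingSolver using (solve)
open import Data.List using (_∷_; [])
open import Data.Fin using (Fin; toℕ; fromℕ<; punchOut)
import Data.Fin.Properties as Fin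
open import Data.Product using (_,_)
open import Data.Empty using (⊥-elim)
open import Function.Definitions using (Injective)
open import Relation.Binary.PropositionalEquality
open import Relation.Nullary using (yes; no; ¬_)
open import Defs

injective⇒∃! : ∀ {n} (f : Fin n → Fin n) → Injective _≡_ _≡_ f →
               ∀ s → ∃! λ x → f x ≡ s
injective⇒∃! {suc n} f f-inj s with Fin.any? (λ x → f x Fin.≟ s)
... | yes (x , fx≡s) = x , fx≡s , λ y fy≡s → f-inj (trans fy≡s (sym fx≡s))
... | no ¬hit = ⊥-elim (1+n≰n (Fin.injective⇒≤ g-inj))
  where
  s≢f : ∀ x → s ≢ f x
  s≢f x s≡fx = ¬hit (x , sym s≡fx)
  g : Fin (suc n) → Fin n
  g x = punchOut (s≢f x)
  g-inj : Injective _≡_ _≡_ g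
  g-inj {x} {y} gx≡gy = f-inj (Fin.punchOut-injective (s≢f x) (s≢f y) gx≡gy)

module _ (n : ℕ) .{{_ : NonZero n}} where
  open ≡-Reasoning

  +-congʳ-mod : ∀ {a b} c → a % n ≡ b % n → (a + c) % n ≡ (b + c) % n
  +-congʳ-mod {a} {b} c a≡b = begin
    (a + c) % n           ≡⟨ %-distribˡ-+ a c n ⟩
    (a % n + c % n) % n   ≡⟨ cong (λ t → (t + c % n) % n) a≡b ⟩
    (b % n + c % n) % n   ≡⟨ %-distribˡ-+ b c n ⟨
    (b + c) % n           ∎

  *-congʳ-mod : ∀ {a b} c → a % n ≡ b % n → (a * c) % n ≡ (b * c) % n
  *-congʳ-mod {a} {b} c a≡b = begin
    (a * c) % n             ≡⟨ %-distribˡ-* a c n ⟩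
    (a % n * (c % n)) % n   ≡⟨ cong (λ t → (t * (c % n)) % n) a≡b ⟩
    (b % n * (c % n)) % n   ≡⟨ %-distribˡ-* b c n ⟨
    (b * c) % n             ∎

  +-cancelʳ-mod : ∀ a b c → (a + c) % n ≡ (b + c) % n → a % n ≡ b % n
  +-cancelʳ-mod a b c a+c≡b+c = begin
    a % n                      ≡⟨ [m+kn]%n≡m%n a c n ⟨
    (a + c * n) % n            ≡⟨ cong (_% n) (split a) ⟩
    ((a + c) + c * pred) % n   ≡⟨ +-congʳ-mod (c * pred) a+c≡b+c ⟩
    ((b + c) + c * pred) % n   ≡⟨ cong (_% n) (split b) ⟨
    (b + c * n) % n            ≡⟨ [m+kn]%n≡m%n b c n ⟩
    b % n                      ∎
    where
    pred : ℕ
    pred = n ∸ 1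
    n≡1+pred : n ≡ suc pred
    n≡1+pred = sym (suc-pred n)
    split : ∀ x → x + c * n ≡ (x + c) + c * pred
    split x = trans (cong (λ t → x + c * t) n≡1+pred) (regroup x pred)
      where
      regroup : ∀ x p → x + c * suc p ≡ (x + c) + c * p
      regroup x p = solve (x ∷ c ∷ p ∷ [])

  +-cancelˡ-mod : ∀ c a b → (c + a) % n ≡ (c + b) % n → a % n ≡ b % n
  +-cancelˡ-mod c a b c+a≡c+b = +-cancelʳ-mod a b c
    (trans (cong (_% n) (+-comm a c)) (trans c+a≡c+b (cong (_% n) (+-comm c b))))

  *-cancelʳ-mod : ∀ {m} m′ → (m * m′) % n ≡ 1 % n →
                  ∀ {x y} → x < n → y < n → (x * m) % n ≡ (y * m) % n → x ≡ y
  *-cancelʳ-mod {m} m′ unit {x} {y} x<n y<n xm≡ym = begin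
    x                   ≡⟨ undo x x<n ⟩
    (x * m * m′) % n    ≡⟨ *-congʳ-mod m′ xm≡ym ⟩
    (y * m * m′) % n    ≡⟨ undo y y<n ⟨
    y                   ∎
    where
    undo : ∀ z → z < n → z ≡ (z * m * m′) % n
    undo z z<n = begin
      z                    ≡⟨ m<n⇒m%n≡m z<n ⟨
      z % n                ≡⟨ cong (_% n) (*-identityˡ z) ⟨
      (1 * z) % n          ≡⟨ *-congʳ-mod z unit ⟨
      (m * m′ * z) % n     ≡⟨ cong (_% n) (solve (m ∷ m′ ∷ z ∷ [])) ⟩
      (z * m * m′) % n     ∎

cyclic-isLatinSquare : ∀ n (c : Fin (suc n) → Fin (suc n)) → Injective _≡_ _≡_ c →
  IsLatinSquare (suc n) (λ r j → fromℕ< (m%n<n (toℕ (c r) + toℕ j) (suc n)))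
cyclic-isLatinSquare n c c-inj =
  (λ r → injective⇒∃! (L r) (row-injective r)) ,
  (λ j → injective⇒∃! (λ r → L r j) (column-injective j))
  where
  L : Fin (suc n) → Fin (suc n) → Fin (suc n)
  L r j = fromℕ< (m%n<n (toℕ (c r) + toℕ j) (suc n))

  toℕ-L : ∀ r j → toℕ (L r j) ≡ (toℕ (c r) + toℕ j) % suc n
  toℕ-L r j = Fin.toℕ-fromℕ< (m%n<n (toℕ (c r) + toℕ j) (suc n))

  toℕ-injective-mod : ∀ {x y : Fin (suc n)} → toℕ x % suc n ≡ toℕ y % suc n → x ≡ y
  toℕ-injective-mod {x} {y} x≡y = Fin.toℕ-injective (begin
    toℕ x           ≡⟨ m<n⇒m%n≡m (Fin.toℕ<n x) ⟨
    toℕ x % suc n   ≡⟨ x≡y ⟩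
    toℕ y % suc n   ≡⟨ m<n⇒m%n≡m (Fin.toℕ<n y) ⟩
    toℕ y           ∎)
    where open ≡-Reasoning

  L≡L : ∀ {r j r′ j′} → L r j ≡ L r′ j′ →
        (toℕ (c r) + toℕ j) % suc n ≡ (toℕ (c r′) + toℕ j′) % suc n
  L≡L {r} {j} {r′} {j′} e = trans (sym (toℕ-L r j)) (trans (cong toℕ e) (toℕ-L r′ j′))

  row-injective : ∀ r → Injective _≡_ _≡_ (L r)
  row-injective r {j} {j′} e =
    toℕ-injective-mod (+-cancelˡ-mod (suc n) (toℕ (c r)) (toℕ j) (toℕ j′) (L≡L e))

  column-injective : ∀ j → Injective _≡_ _≡_ (λ r → L r j)
  column-injective j {r} {r′} e =
    c-inj (toℕ-injective-mod (+-cancelʳ-mod (suc n) (toℕ (c r)) (toℕ (c r′)) (toℕ j) (L≡L e)))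

module Reflection (h N : ℕ) where

  reflect : (ℕ → ℕ) → ℕ → ℕ
  reflect f r with r ≤? h
  ... | yes _ = f r
  ... | no  _ = N ∸ f (N ∸ r)

  reflect-low : ∀ f {r} → r ≤ h → reflect f r ≡ f r
  reflect-low f {r} r≤h with r ≤? h
  ... | yes _   = refl
  ... | no  r≰h = ⊥-elim (r≰h r≤h)

  reflect-high : ∀ f {r} → ¬ r ≤ h → reflect f r ≡ N ∸ f (N ∸ r)
  reflect-high f {r} r≰h with r ≤? h
  ... | yes r≤h = ⊥-elim (r≰h r≤h)
  ... | no  _   = refl

  MapsInto : (ℕ → ℕ) → Set
  MapsInto f = ∀ {r} → r ≤ h → f r ≤ h

  module Properties (N≡h+1+h : N ≡ h + suc h) where

    h≤N : h ≤ N
    h≤N = subst (h ≤_) (sym N≡h+1+h) (m≤m+n h (suc h))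

    N∸high≤h : ∀ {r} → ¬ r ≤ h → N ∸ r ≤ h
    N∸high≤h {r} r≰h = begin
      N ∸ r                   ≤⟨ ∸-monoʳ-≤ N (≰⇒> r≰h) ⟩
      N ∸ suc h               ≡⟨ cong (_∸ suc h) N≡h+1+h ⟩
      h + suc h ∸ suc h       ≡⟨ m+n∸n≡m h (suc h) ⟩
      h                       ∎
      where open ≤-Reasoning

    N∸low≰h : ∀ {x} → x ≤ h → ¬ N ∸ x ≤ h
    N∸low≰h {x} x≤h N∸x≤h = 1+n≰n (begin
      suc h                   ≡⟨ m+n∸n≡m (suc h) h ⟨
      suc h + h ∸ h           ≡⟨ cong (_∸ h) (trans (+-comm (suc h) h) (sym N≡h+1+h)) ⟩
      N ∸ h                   ≤⟨ ∸-monoʳ-≤ N x≤h ⟩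
      N ∸ x                   ≤⟨ N∸x≤h ⟩
      h                       ∎)
      where open ≤-Reasoning

    reflect-≤ : ∀ {f : ℕ → ℕ} → MapsInto f → ∀ r → reflect f r ≤ N
    reflect-≤ {f} f-into r with r ≤? h
    ... | yes r≤h = ≤-trans (f-into r≤h) h≤N
    ... | no  _   = m∸n≤m N (f (N ∸ r))

    reflect-inverseˡ : ∀ {f g : ℕ → ℕ} → MapsInto f → (∀ {r} → r ≤ h → g (f r) ≡ r) →
                       ∀ {r} → r ≤ N → reflect g (reflect f r) ≡ r
    reflect-inverseˡ {f} {g} f-into g∘f≡id {r} r≤N with r ≤? h
    ... | yes r≤h = trans (reflect-low g (f-into r≤h)) (g∘f≡id r≤h)
    ... | no  r≰h = begin
      reflect g (N ∸ f r′)          ≡⟨ reflect-high g (N∸low≰h (f-into r′≤h)) ⟩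
      N ∸ g (N ∸ (N ∸ f r′))        ≡⟨ cong (λ t → N ∸ g t) (m∸[m∸n]≡n (≤-trans (f-into r′≤h) h≤N)) ⟩
      N ∸ g (f r′)                  ≡⟨ cong (N ∸_) (g∘f≡id r′≤h) ⟩
      N ∸ (N ∸ r)                   ≡⟨ m∸[m∸n]≡n r≤N ⟩
      r                             ∎
      where
      open ≡-Reasoning
      r′ : ℕ
      r′ = N ∸ r
      r′≤h : r′ ≤ h
      r′≤h = N∸high≤h {r} r≰h

    reflect-natural : ∀ {f F φ : ℕ → ℕ} → MapsInto f → (∀ {r} → r ≤ h → F r ≡ φ (f r)) →
                      (∀ {y} → y ≤ h → φ (N ∸ y) ≡ N ∸ φ y) →
                      ∀ r → reflect F r ≡ φ (reflect f r)
    reflect-natural {f} {F} {φ} f-into F≡φ∘f φ-antipodal r with r ≤? h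
    ... | yes r≤h = F≡φ∘f r≤h
    ... | no  r≰h = begin
      N ∸ F (N ∸ r)           ≡⟨ cong (N ∸_) (F≡φ∘f (N∸high≤h {r} r≰h)) ⟩
      N ∸ φ (f (N ∸ r))       ≡⟨ φ-antipodal (f-into (N∸high≤h {r} r≰h)) ⟨
      φ (N ∸ f (N ∸ r))       ∎
      where open ≡-Reasoning

module Unshuffle (d : ℕ) where

  unshuffle : ℕ → ℕ
  unshuffle r with r % 2 ≟ 0
  ... | yes _ = r / 2
  ... | no  _ = r / 2 + suc d

  shuffle : ℕ → ℕ
  shuffle j with j ≤? d
  ... | yes _ = j * 2
  ... | no  _ = suc ((j ∸ suc d) * 2)

  shuffle-low : ∀ {j} → j ≤ d → shuffle j ≡ j * 2
  shuffle-low {j} j≤d with j ≤? d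
  ... | yes _   = refl
  ... | no  j≰d = ⊥-elim (j≰d j≤d)

  shuffle-high : ∀ {j} → ¬ j ≤ d → shuffle j ≡ suc ((j ∸ suc d) * 2)
  shuffle-high {j} j≰d with j ≤? d
  ... | yes j≤d = ⊥-elim (j≰d j≤d)
  ... | no  _   = refl

  even≡half*2 : ∀ r → r % 2 ≡ 0 → r ≡ r / 2 * 2
  even≡half*2 r r%2≡0 = trans (m≡m%n+[m/n]*n r 2) (cong (_+ r / 2 * 2) r%2≡0)

  odd≡1+half*2 : ∀ r → r % 2 ≢ 0 → r ≡ suc (r / 2 * 2)
  odd≡1+half*2 r r%2≢0 with r % 2 | m%n<n r 2 | m≡m%n+[m/n]*n r 2
  ... | zero        | _                | _ = ⊥-elim (r%2≢0 refl)
  ... | suc zero    | _                | r≡ = r≡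
  ... | suc (suc _) | s≤s (s≤s ())   | _

  module Properties (h : ℕ) (h≡d+d : h ≡ d + d) where

    d*2≡h : d * 2 ≡ h
    d*2≡h = trans (*-comm d 2) (trans (cong (d +_) (+-identityʳ d)) (sym h≡d+d))

    even-half≤d : ∀ {r} → r % 2 ≡ 0 → r ≤ h → r / 2 ≤ d
    even-half≤d {r} r%2≡0 r≤h =
      *-cancelʳ-≤ (r / 2) d 2 (subst₂ _≤_ (even≡half*2 r r%2≡0) (sym d*2≡h) r≤h)

    odd-half<d : ∀ {r} → r % 2 ≢ 0 → r ≤ h → r / 2 < d
    odd-half<d {r} r%2≢0 r≤h =
      *-cancelʳ-< 2 (r / 2) d (subst₂ _≤_ (odd≡1+half*2 r r%2≢0) (sym d*2≡h) r≤h)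

    d≤h : d ≤ h
    d≤h = subst (d ≤_) (sym h≡d+d) (m≤m+n d d)

    odd-image≤h : ∀ {i} → i < d → i + suc d ≤ h
    odd-image≤h {i} i<d = begin
      i + suc d   ≡⟨ +-suc i d ⟩
      suc i + d   ≤⟨ +-monoˡ-≤ d i<d ⟩
      d + d       ≡⟨ h≡d+d ⟨
      h           ∎
      where open ≤-Reasoning

    unshuffle-≤ : ∀ {r} → r ≤ h → unshuffle r ≤ h
    unshuffle-≤ {r} r≤h with r % 2 ≟ 0
    ... | yes r%2≡0 = ≤-trans (even-half≤d r%2≡0 r≤h) d≤h
    ... | no  r%2≢0 = odd-image≤h (odd-half<d r%2≢0 r≤h)

    shuffle-unshuffle : ∀ {r} → r ≤ h → shuffle (unshuffle r) ≡ r
    shuffle-unshuffle {r} r≤h with r % 2 ≟ 0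
    ... | yes r%2≡0 = trans (shuffle-low (even-half≤d r%2≡0 r≤h)) (sym (even≡half*2 r r%2≡0))
    ... | no  r%2≢0 = begin
      shuffle (r / 2 + suc d)             ≡⟨ shuffle-high (λ le → 1+n≰n (≤-trans (m≤n+m (suc d) (r / 2)) le)) ⟩
      suc ((r / 2 + suc d ∸ suc d) * 2)   ≡⟨ cong (λ t → suc (t * 2)) (m+n∸n≡m (r / 2) (suc d)) ⟩
      suc (r / 2 * 2)                     ≡⟨ odd≡1+half*2 r r%2≢0 ⟨
      r                                   ∎
      where open ≡-Reasoning

module Affine (N A m : ℕ) where
  open ≡-Reasoning

  affine : ℕ → ℕ
  affine x = (A + x * m) % suc N

  affine≤N : ∀ x → affine x ≤ N
  affine≤N x = ≤-pred (m%n<n (A + x * m) (suc N))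

  affine-injective : ∀ m′ → (m * m′) % suc N ≡ 1 % suc N →
                     ∀ {x y} → x ≤ N → y ≤ N → affine x ≡ affine y → x ≡ y
  affine-injective m′ unit x≤N y≤N ax≡ay =
    *-cancelʳ-mod (suc N) m′ unit (s≤s x≤N) (s≤s y≤N) (+-cancelˡ-mod (suc N) A _ _ ax≡ay)

  -- Both N ∸ affine y and affine (N ∸ y) add up with affine y to N modulo N + 1.
  affine-antipodal : (A + A + N * m) % suc N ≡ N % suc N →
                     ∀ {y} → y ≤ N → affine (N ∸ y) ≡ N ∸ affine y
  affine-antipodal sum≡N {y} y≤N = sym (begin
    N ∸ affine y                  ≡⟨ m<n⇒m%n≡m (s≤s (m∸n≤m N (affine y))) ⟨
    (N ∸ affine y) % suc N        ≡⟨ +-cancelʳ-mod (suc N) (N ∸ affine y) (affine (N ∸ y)) (affine y) complement ⟩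
    affine (N ∸ y) % suc N        ≡⟨ m%n%n≡m%n (A + (N ∸ y) * m) (suc N) ⟩
    affine (N ∸ y)                ∎)
    where
    pair-sum : (A + (N ∸ y) * m) + (A + y * m) ≡ A + A + N * m
    pair-sum = begin
      (A + (N ∸ y) * m) + (A + y * m)   ≡⟨ regroup (N ∸ y) ⟩
      A + A + ((N ∸ y) + y) * m         ≡⟨ cong (λ t → A + A + t * m) (m∸n+n≡m y≤N) ⟩
      A + A + N * m                     ∎
      where
      regroup : ∀ s → (A + s * m) + (A + y * m) ≡ A + A + (s + y) * m
      regroup s = solve (A ∷ s ∷ y ∷ m ∷ [])
    complement : (N ∸ affine y + affine y) % suc N ≡ (affine (N ∸ y) + affine y) % suc N
    complement = begin
      (N ∸ affine y + affine y) % suc N             ≡⟨ cong (_% suc N) (m∸n+n≡m (affine≤N y)) ⟩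
      N % suc N                                     ≡⟨ sum≡N ⟨
      (A + A + N * m) % suc N                       ≡⟨ cong (_% suc N) pair-sum ⟨
      ((A + (N ∸ y) * m) + (A + y * m)) % suc N     ≡⟨ %-distribˡ-+ (A + (N ∸ y) * m) (A + y * m) (suc N) ⟩
      (affine (N ∸ y) + affine y) % suc N           ∎

module _ (k : ℕ) where
  open ≡-Reasoning
  open Reflection (24 * k + 10) (48 * k + 21)
  open Reflection.Properties (24 * k + 10) (48 * k + 21) (solve (k ∷ []))
  open Unshuffle (12 * k + 5)
  open Unshuffle.Properties (12 * k + 5) (24 * k + 10) (solve (k ∷ []))
  open Affine (48 * k + 21) (30 * k + 14) (12 * k + 7)

  σ : ℕ → ℕ
  σ = reflect unshuffle

  c3ℕ≡reflect : ∀ r → c3ℕ k r ≡ reflect (λ r → c3-half k r % ord k) r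
  c3ℕ≡reflect r with r ≤? 24 * k + 10
  ... | yes _ = refl
  ... | no  _ = refl

  c3-half≡affine : ∀ r → c3-half k r % ord k ≡ affine (unshuffle r)
  c3-half≡affine r with r % 2 ≟ 0
  ... | yes _ = refl
  ... | no  _ = begin
    (24 * k + 12 + r / 2 * (12 * k + 7)) % ord k                              ≡⟨ [m+kn]%n≡m%n (24 * k + 12 + r / 2 * (12 * k + 7)) (3 * k + 2) (ord k) ⟨
    (24 * k + 12 + r / 2 * (12 * k + 7) + (3 * k + 2) * ord k) % ord k        ≡⟨ cong (_% ord k) (odd-shift (r / 2)) ⟩
    affine (r / 2 + suc (12 * k + 5))                                         ∎
    where
    odd-shift : ∀ i → 24 * k + 12 + i * (12 * k + 7) + (3 * k + 2) * suc (48 * k + 21)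
                    ≡ 30 * k + 14 + (i + suc (12 * k + 5)) * (12 * k + 7)
    odd-shift i = solve (k ∷ i ∷ [])

  antipodal-sum : (30 * k + 14 + (30 * k + 14) + (48 * k + 21) * (12 * k + 7)) % ord k ≡ (48 * k + 21) % ord k
  antipodal-sum = begin
    (30 * k + 14 + (30 * k + 14) + (48 * k + 21) * (12 * k + 7)) % ord k  ≡⟨ cong (_% ord k) sum≡ ⟩
    (48 * k + 21 + (12 * k + 7) * suc (48 * k + 21)) % ord k              ≡⟨ [m+kn]%n≡m%n (48 * k + 21) (12 * k + 7) (ord k) ⟩
    (48 * k + 21) % ord k                                                 ∎
    where
    sum≡ : 30 * k + 14 + (30 * k + 14) + (48 * k + 21) * (12 * k + 7) ≡ 48 * k + 21 + (12 * k + 7) * suc (48 * k + 21)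
    sum≡ = solve (k ∷ [])

  c3ℕ≡affine∘σ : ∀ r → c3ℕ k r ≡ affine (σ r)
  c3ℕ≡affine∘σ r = trans (c3ℕ≡reflect r)
    (reflect-natural {φ = affine} unshuffle-≤ (λ {r} _ → c3-half≡affine r)
      (λ y≤h → affine-antipodal antipodal-sum (≤-trans y≤h h≤N)) r)

  toℕ-c3≡affine∘σ : ∀ r → toℕ (c3 k r) ≡ affine (σ r)
  toℕ-c3≡affine∘σ r = begin
    toℕ (c3 k r)           ≡⟨ Fin.toℕ-fromℕ< (m%n<n (c3ℕ k r) (ord k)) ⟩
    c3ℕ k r % ord k        ≡⟨ cong (_% ord k) (c3ℕ≡affine∘σ r) ⟩
    affine (σ r) % ord k   ≡⟨ m%n%n≡m%n (30 * k + 14 + σ r * (12 * k + 7)) (ord k) ⟩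
    affine (σ r)           ∎

  multiplier-unit : ((12 * k + 7) * (40 * k + 19)) % ord k ≡ 1 % ord k
  multiplier-unit = begin
    ((12 * k + 7) * (40 * k + 19)) % ord k           ≡⟨ cong (_% ord k) product≡ ⟩
    (1 + (10 * k + 6) * suc (48 * k + 21)) % ord k   ≡⟨ [m+kn]%n≡m%n 1 (10 * k + 6) (ord k) ⟩
    1 % ord k                                        ∎
    where
    product≡ : (12 * k + 7) * (40 * k + 19) ≡ 1 + (10 * k + 6) * suc (48 * k + 21)
    product≡ = solve (k ∷ [])

  c3-injective : Injective _≡_ _≡_ (λ (r : Fin (ord k)) → c3 k (toℕ r))
  c3-injective {r} {r′} c3r≡c3r′ = Fin.toℕ-injective (begin
    toℕ r                       ≡⟨ σ-inverse r ⟨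
    reflect shuffle (σ (toℕ r))  ≡⟨ cong (reflect shuffle) σr≡σr′ ⟩
    reflect shuffle (σ (toℕ r′)) ≡⟨ σ-inverse r′ ⟩
    toℕ r′                      ∎)
    where
    σ-inverse : ∀ (x : Fin (ord k)) → reflect shuffle (σ (toℕ x)) ≡ toℕ x
    σ-inverse x = reflect-inverseˡ unshuffle-≤ shuffle-unshuffle (≤-pred (Fin.toℕ<n x))
    σr≡σr′ : σ (toℕ r) ≡ σ (toℕ r′)
    σr≡σr′ = affine-injective (40 * k + 19) multiplier-unit
      (reflect-≤ unshuffle-≤ (toℕ r)) (reflect-≤ unshuffle-≤ (toℕ r′))
      (trans (sym (toℕ-c3≡affine∘σ (toℕ r))) (trans (cong toℕ c3r≡c3r′) (toℕ-c3≡affine∘σ (toℕ r′))))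

lemma6 : (k : ℕ) → IsLatinSquare (ord k) (L3 k)
lemma6 k = cyclic-isLatinSquare (48 * k + 21) (λ r → c3 k (toℕ r)) (c3-injective k)
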